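{- Let $X$ be a countably infinite set, let $a_1,\dots,a_n\in X$ be distinct with $n\ge2$, let $z\notin X$ and $Y=X\cup\{z\}$. Then there exist a forgetful swap $f_1$ and a retentive swap $f_2$ on $Y$ such that $z\in\mathrm{dom}(f_1)$, $z\in\mathrm{dom}(f_2)$, $\mathrm{dom}(f_1)\neq\mathrm{dom}(f_2)$, $f_2\circ f_1$ is defined on all of $Y$, $f_2(f_1(a))=(a_1\;\cdots\;a_n)^{ -1}(a)$ for all $a\in X$, and $f_2(f_1(z))=z$.
   Context: A swap on a set $Y$ is specified by an infinite sequence $c=(c_1,c_2,\dots)$ of pairwise distinct elements of $Y$; its domain is $\mathrm{dom}=\{c_1,c_2,\dots\}$. The forgetful swap with sequence $c$ is the map $F:Y\to Y$ with $F(c_i)=c_{i+1}$ ($i\ge1$) and $F(y)=y$ for $y\notin\mathrm{dom}$. The retentive swap with sequence $c$ is the partial map $G$ defined on $Y\setminus\{c_1\}$ by $G(c_{i+1})=c_i$ ($i\ge1$) and $G(y)=y$ for $y\notin\mathrm{dom}$; it is undefined at $c_1$. Compositions are of (partial) functions with the rightmost applied first; a composition is defined on $Y$ if at every stage the current point lies where the next map is defined. $(a_1\;\cdots\;a_n)$ is the cyclic permutation of $X$ sending $a_i\mapsto a_{i+1}$, $a_n\mapsto a_1$ and fixing everything else. -}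

module Defs where

open import Data.Nat using (ℕ; zero; suc)
import Data.Nat as ℕ
open import Data.Nat.DivMod using (_mod_)
open import Data.Fin using (Fin; toℕ; opposite)
open import Data.Fin.Properties using (any?)
open import Data.Maybe using (Maybe; just; nothing)
open import Data.Product using (Σ; ∃; _,_; _×_)
open import Data.Sum using (_⊎_; inj₁; inj₂)
open import Data.Unit using (⊤; tt)
open import Function using (_∘_)
open import Function.Bundles using (_↔_; Inverse)
open import Relation.Binary.Definitions using (DecidableEquality)
open import Relation.Binary.PropositionalEquality using (_≡_; _≢_; cong; sym; trans)
open import Relation.Nullary using (¬_; yes; no)
open import Relation.Nullary.Decidable using (map′)

CountablyInfinite : Set → Set
CountablyInfinite X = X ↔ ℕ

decEqCI : {X : Set} → CountablyInfinite X → DecidableEquality X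
decEqCI e x y = map′ inj (cong (Inverse.to e)) (Inverse.to e x ℕ.≟ Inverse.to e y)
  where
  inj : Inverse.to e x ≡ Inverse.to e y → x ≡ y
  inj p = trans (sym (Inverse.strictlyInverseʳ e x))
                (trans (cong (Inverse.from e) p) (Inverse.strictlyInverseʳ e y))

-- Y = X ∪ {z}, with z ∉ X the new point.
Ext : Set → Set
Ext X = X ⊎ ⊤

zPt : {X : Set} → Ext X
zPt = inj₂ tt

Distinct : {Y : Set} → (ℕ → Y) → Set
Distinct c = ∀ i j → c i ≡ c j → i ≡ j

InDom : {Y : Set} → (ℕ → Y) → Y → Set
InDom c y = ∃ λ i → c i ≡ y

IsForgetfulSwap : {Y : Set} → (ℕ → Y) → (Y → Y) → Set
IsForgetfulSwap c F =
  Distinct c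
  × (∀ i → F (c i) ≡ c (suc i))
  × (∀ y → ¬ InDom c y → F y ≡ y)

-- G is the retentive swap with sequence c; as a partial map Y → Maybe Y,
-- undefined (nothing) exactly at c 0 (= c₁ in the paper's 1-based indexing).
IsRetentiveSwap : {Y : Set} → (ℕ → Y) → (Y → Maybe Y) → Set
IsRetentiveSwap c G =
  Distinct c
  × (G (c 0) ≡ nothing)
  × (∀ i → G (c (suc i)) ≡ just (c i))
  × (∀ y → ¬ InDom c y → G y ≡ just y)

-- Successor index modulo n (indices 0..n-1 stand for 1..n).
nextIdx : {n : ℕ} → Fin n → Fin n
nextIdx {suc m} i = suc (toℕ i) mod suc m

cycle : {X : Set} → DecidableEquality X → {n : ℕ} → (Fin n → X) → X → X
cycle _≟_ a x with any? (λ i → a i ≟ x)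
... | yes (i , _) = a (nextIdx i)
... | no _ = x

-- Its inverse (a₁ ⋯ aₙ)⁻¹ = (aₙ ⋯ a₁).
cycleInv : {X : Set} → DecidableEquality X → {n : ℕ} → (Fin n → X) → X → X
cycleInv _≟_ a = cycle _≟_ (a ∘ opposite)

-- Enumerate X through e and pick the tail b₀, b₁, … of elements numbered past every aᵢ.
-- The forgetful swap along z, a₁, b₀, b₁, … sends z ↦ a₁ ↦ b₀ and shifts the b's up;
-- the retentive swap along z, a₁, …, aₙ, b₀, b₁, … shifts everything back by one.
-- Composing, z ↦ z, a₁ ↦ b₀ ↦ aₙ, aᵢ₊₁ ↦ aᵢ, bₜ ↦ bₜ₊₁ ↦ bₜ, and all other points are fixed
-- by both swaps, which is exactly (a₁ ⋯ aₙ)⁻¹ on X.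
module Submission where

open import Defs
open import Data.Empty using (⊥-elim)
open import Data.Fin using (Fin; zero; suc; toℕ; fromℕ; inject₁; opposite)
open import Data.Fin.Properties
  using (any?; toℕ-injective; toℕ-fromℕ<; toℕ-fromℕ; toℕ-inject₁; toℕ<n;
         0≢1+n; suc-injective; opposite-involutive)
open import Data.Maybe using (Maybe; just; nothing)
open import Data.Nat using (ℕ; zero; suc; _+_; _∸_; _⊔_; _≤_; _<_; _≥_; _≤?_; _%_; z≤n; s≤s)
import Data.Nat.Properties as ℕ
open import Data.Nat.DivMod using (n%n≡0; m<n⇒m%n≡m)
open import Data.Nat.Properties
  using (m≤m+n; m+[n∸m]≡n; +-cancelˡ-≡; m≤m⊔n; m≤n⊔m; <-≤-trans; <⇒≱; +-identityʳ; +-suc)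
open import Data.Product using (Σ; ∃; _×_; _,_; proj₁; proj₂)
open import Data.Sum using (_⊎_; inj₁; inj₂; [_,_])
import Data.Sum as ⊎
open import Data.Sum.Properties using (inj₁-injective; ≡-dec)
import Data.Unit.Properties as ⊤
open import Function using (_∘_)
open import Function.Bundles using (_↔_; _⇔_; Inverse; Injection; Equivalence)
open import Function.Definitions using (Injective)
open import Function.Properties.Inverse using (↔-sym; ↔⇒↣)
open import Relation.Binary.Definitions using (DecidableEquality)
open import Relation.Binary.PropositionalEquality
  using (_≡_; _≢_; refl; sym; trans; cong; subst; module ≡-Reasoning)
open import Relation.Nullary using (¬_; Dec; yes; no; contradiction)
open import Relation.Nullary.Decidable using (map′)

module _ {Y : Set} where

  infixr 5 _∷ˢ_ _++ˢ_

  _∷ˢ_ : Y → (ℕ → Y) → ℕ → Y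
  (x ∷ˢ c) zero = x
  (x ∷ˢ c) (suc i) = c i

  _++ˢ_ : {n : ℕ} → (Fin n → Y) → (ℕ → Y) → ℕ → Y
  _++ˢ_ {zero} v c = c
  _++ˢ_ {suc n} v c = v zero ∷ˢ (v ∘ suc) ++ˢ c

  inDom-∷ˢ⁻ : ∀ {x c y} → InDom (x ∷ˢ c) y → x ≡ y ⊎ InDom c y
  inDom-∷ˢ⁻ (zero , p) = inj₁ p
  inDom-∷ˢ⁻ (suc i , p) = inj₂ (i , p)

  inDom-∷ˢ? : DecidableEquality Y → ∀ {x c} →
              (∀ y → Dec (InDom c y)) → ∀ y → Dec (InDom (x ∷ˢ c) y)
  inDom-∷ˢ? _≟_ {x} c? y with x ≟ y | c? y
  ... | yes x≡y | _ = yes (zero , x≡y)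
  ... | no _ | yes (i , p) = yes (suc i , p)
  ... | no x≢y | no y∉c = no ([ x≢y , y∉c ] ∘ inDom-∷ˢ⁻)

  ∷ˢ-distinct : ∀ {x c} → ¬ InDom c x → Distinct c → Distinct (x ∷ˢ c)
  ∷ˢ-distinct x∉c d zero zero _ = refl
  ∷ˢ-distinct x∉c d zero (suc j) p = ⊥-elim (x∉c (j , sym p))
  ∷ˢ-distinct x∉c d (suc i) zero p = ⊥-elim (x∉c (i , p))
  ∷ˢ-distinct x∉c d (suc i) (suc j) p = cong suc (d i j p)

  ++ˢ-lookup : ∀ {n} (v : Fin n → Y) c i → (v ++ˢ c) (toℕ i) ≡ v i
  ++ˢ-lookup v c zero = refl
  ++ˢ-lookup v c (suc i) = ++ˢ-lookup (v ∘ suc) c i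

  ++ˢ-drop : ∀ {n} (v : Fin n → Y) c t → (v ++ˢ c) (n + t) ≡ c t
  ++ˢ-drop {zero} v c t = refl
  ++ˢ-drop {suc n} v c t = ++ˢ-drop (v ∘ suc) c t

  inDom-++ˢ⁻ : ∀ {n} {v : Fin n → Y} {c y} →
               InDom (v ++ˢ c) y → (∃ λ i → v i ≡ y) ⊎ InDom c y
  inDom-++ˢ⁻ {zero} y∈ = inj₂ y∈
  inDom-++ˢ⁻ {suc n} {v} y∈ =
    [ (λ v₀≡y → inj₁ (zero , v₀≡y)) , ⊎.map₁ (λ (i , p) → suc i , p) ∘ inDom-++ˢ⁻ {v = v ∘ suc} ]
      (inDom-∷ˢ⁻ y∈)

  inDom-++ˢ? : DecidableEquality Y → ∀ {n} {v : Fin n → Y} {c} →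
               (∀ y → Dec (InDom c y)) → ∀ y → Dec (InDom (v ++ˢ c) y)
  inDom-++ˢ? _≟_ {zero} c? = c?
  inDom-++ˢ? _≟_ {suc n} {v} c? = inDom-∷ˢ? _≟_ (inDom-++ˢ? _≟_ {v = v ∘ suc} c?)

  ++ˢ-distinct : ∀ {n} {v : Fin n → Y} {c} → Injective _≡_ _≡_ v →
                 (∀ i → ¬ InDom c (v i)) → Distinct c → Distinct (v ++ˢ c)
  ++ˢ-distinct {zero} _ _ d = d
  ++ˢ-distinct {suc n} {v} v-inj v∉c d =
    ∷ˢ-distinct v₀∉ (++ˢ-distinct {v = v ∘ suc} (suc-injective ∘ v-inj) (v∉c ∘ suc) d)
    where
    v₀∉ : ¬ InDom ((v ∘ suc) ++ˢ _) (v zero)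
    v₀∉ = [ (λ (i , p) → 0≢1+n (v-inj (sym p))) , v∉c zero ] ∘ inDom-++ˢ⁻ {v = v ∘ suc}

module _ {A B : Set} {g : A → B} (g-inj : Injective _≡_ _≡_ g) {c : ℕ → A} where

  distinct-∘ : Distinct c → Distinct (g ∘ c)
  distinct-∘ d i j = d i j ∘ g-inj

  inDom-∘⁻ : ∀ {x} → InDom (g ∘ c) (g x) → InDom c x
  inDom-∘⁻ (i , p) = i , g-inj p

inDom-inj₁? : {A B : Set} {c : ℕ → A} →
              (∀ x → Dec (InDom c x)) → ∀ (y : A ⊎ B) → Dec (InDom (inj₁ ∘ c) y)
inDom-inj₁? c? (inj₁ x) = map′ (λ (i , p) → i , cong inj₁ p) (inDom-∘⁻ inj₁-injective) (c? x)
inDom-inj₁? c? (inj₂ _) = no λ { (_ , ()) }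

module _ {Y : Set} (c : ℕ → Y) (c? : ∀ y → Dec (InDom c y)) where

  forgetfulSwap : Y → Y
  forgetfulSwap y with c? y
  ... | yes (i , _) = c (suc i)
  ... | no _ = y

  retentiveSwap : Y → Maybe Y
  retentiveSwap y with c? y
  ... | yes (zero , _) = nothing
  ... | yes (suc i , _) = just (c i)
  ... | no _ = just y

  forgetfulSwap-fixes : ∀ y → ¬ InDom c y → forgetfulSwap y ≡ y
  forgetfulSwap-fixes y y∉c with c? y
  ... | yes y∈c = contradiction y∈c y∉c
  ... | no _ = refl

  retentiveSwap-fixes : ∀ y → ¬ InDom c y → retentiveSwap y ≡ just y
  retentiveSwap-fixes y y∉c with c? y
  ... | yes (zero , p) = contradiction (zero , p) y∉c
  ... | yes (suc i , p) = contradiction (suc i , p) y∉c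
  ... | no _ = refl

  module _ (d : Distinct c) where

    forgetfulSwap-shift : ∀ i → forgetfulSwap (c i) ≡ c (suc i)
    forgetfulSwap-shift i with c? (c i)
    ... | yes (j , p) = cong (c ∘ suc) (d j i p)
    ... | no c∉c = contradiction (i , refl) c∉c

    retentiveSwap-undefined : retentiveSwap (c zero) ≡ nothing
    retentiveSwap-undefined with c? (c zero)
    ... | yes (zero , _) = refl
    ... | yes (suc j , p) = contradiction (d zero (suc j) (sym p)) λ ()
    ... | no c∉c = contradiction (zero , refl) c∉c

    retentiveSwap-shift : ∀ i → retentiveSwap (c (suc i)) ≡ just (c i)
    retentiveSwap-shift i with c? (c (suc i))
    ... | yes (zero , p) = contradiction (d zero (suc i) p) λ ()
    ... | yes (suc j , p) = cong (just ∘ c) (ℕ.suc-injective (d (suc j) (suc i) p))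
    ... | no c∉c = contradiction (suc i , refl) c∉c

    forgetfulSwap-isForgetfulSwap : IsForgetfulSwap c forgetfulSwap
    forgetfulSwap-isForgetfulSwap = d , forgetfulSwap-shift , forgetfulSwap-fixes

    retentiveSwap-isRetentiveSwap : IsRetentiveSwap c retentiveSwap
    retentiveSwap-isRetentiveSwap =
      d , retentiveSwap-undefined , retentiveSwap-shift , retentiveSwap-fixes

module _ {X : Set} (e : X ↔ ℕ) where

  open Inverse e using (to; from; strictlyInverseˡ; strictlyInverseʳ)

  enumFrom : ℕ → ℕ → X
  enumFrom M t = from (M + t)

  enumFrom-distinct : ∀ M → Distinct (enumFrom M)
  enumFrom-distinct M s t = +-cancelˡ-≡ M s t ∘ Injection.injective (↔⇒↣ (↔-sym e))

  inDom-enumFrom⁻ : ∀ {M x} → InDom (enumFrom M) x → M ≤ to x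
  inDom-enumFrom⁻ {M} (t , p) =
    subst (M ≤_) (trans (sym (strictlyInverseˡ (M + t))) (cong to p)) (m≤m+n M t)

  inDom-enumFrom⁺ : ∀ {M x} → M ≤ to x → InDom (enumFrom M) x
  inDom-enumFrom⁺ {M} {x} M≤x = to x ∸ M , trans (cong from (m+[n∸m]≡n M≤x)) (strictlyInverseʳ x)

  inDom-enumFrom? : ∀ M x → Dec (InDom (enumFrom M) x)
  inDom-enumFrom? M x = map′ inDom-enumFrom⁺ inDom-enumFrom⁻ (M ≤? to x)

strictUpperBound : ∀ {n} (f : Fin n → ℕ) → ∃ λ M → ∀ i → f i < M
strictUpperBound {zero} f = 0 , λ ()
strictUpperBound {suc n} f with strictUpperBound (f ∘ suc)
... | M , f<M = suc (f zero) ⊔ M , λ where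
  zero → m≤m⊔n (suc (f zero)) M
  (suc i) → <-≤-trans (f<M i) (m≤n⊔m (suc (f zero)) M)

toℕ-nextIdx : ∀ {k} (i : Fin (suc k)) → toℕ (nextIdx i) ≡ suc (toℕ i) % suc k
toℕ-nextIdx i = toℕ-fromℕ< _

nextIdx-fromℕ : ∀ k → nextIdx (fromℕ k) ≡ zero
nextIdx-fromℕ k = toℕ-injective (begin
  toℕ (nextIdx (fromℕ k))      ≡⟨ toℕ-nextIdx (fromℕ k) ⟩
  suc (toℕ (fromℕ k)) % suc k  ≡⟨ cong (λ t → suc t % suc k) (toℕ-fromℕ k) ⟩
  suc k % suc k                ≡⟨ n%n≡0 (suc k) ⟩
  0                            ∎)
  where open ≡-Reasoning

nextIdx-inject₁ : ∀ {k} (j : Fin k) → nextIdx (inject₁ j) ≡ suc j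
nextIdx-inject₁ {k} j = toℕ-injective (begin
  toℕ (nextIdx (inject₁ j))      ≡⟨ toℕ-nextIdx (inject₁ j) ⟩
  suc (toℕ (inject₁ j)) % suc k  ≡⟨ cong (λ t → suc t % suc k) (toℕ-inject₁ j) ⟩
  suc (toℕ j) % suc k            ≡⟨ m<n⇒m%n≡m (s≤s (toℕ<n j)) ⟩
  suc (toℕ j)                    ∎)
  where open ≡-Reasoning

module _ {X : Set} (_≟_ : DecidableEquality X) {n : ℕ} where

  cycle-apply : (d : Fin n → X) → Injective _≡_ _≡_ d → ∀ j → cycle _≟_ d (d j) ≡ d (nextIdx j)
  cycle-apply d d-inj j with any? (λ i → d i ≟ d j)
  ... | yes (i , p) = cong (d ∘ nextIdx) (d-inj p)
  ... | no ∄i = contradiction (j , refl) ∄i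

  cycle-fixes : (d : Fin n → X) → ∀ {x} → ¬ (∃ λ i → d i ≡ x) → cycle _≟_ d x ≡ x
  cycle-fixes d {x} ∄i with any? (λ i → d i ≟ x)
  ... | yes ∃i = contradiction ∃i ∄i
  ... | no _ = refl

  cycleInv-fixes : (a : Fin n → X) → ∀ {x} → ¬ (∃ λ i → a i ≡ x) → cycleInv _≟_ a x ≡ x
  cycleInv-fixes a ∄i = cycle-fixes (a ∘ opposite) λ (i , p) → ∄i (opposite i , p)

module _ {X : Set} (_≟_ : DecidableEquality X) {k : ℕ}
         (a : Fin (suc k) → X) (a-inj : Injective _≡_ _≡_ a) where

  open ≡-Reasoning

  cycleInv-opposite : ∀ j → cycleInv _≟_ a (a (opposite j)) ≡ a (opposite (nextIdx j))
  cycleInv-opposite = cycle-apply _≟_ (a ∘ opposite) opposite-a-inj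
    where
    opposite-a-inj : Injective _≡_ _≡_ (a ∘ opposite)
    opposite-a-inj {i} {j} p =
      trans (sym (opposite-involutive i)) (trans (cong opposite (a-inj p)) (opposite-involutive j))

  cycleInv-zero : cycleInv _≟_ a (a zero) ≡ a (fromℕ k)
  cycleInv-zero = begin
    cycleInv _≟_ a (a zero)                   ≡⟨ cong (cycleInv _≟_ a ∘ a) (opposite-involutive zero) ⟨
    cycleInv _≟_ a (a (opposite (fromℕ k)))   ≡⟨ cycleInv-opposite (fromℕ k) ⟩
    a (opposite (nextIdx (fromℕ k)))          ≡⟨ cong (a ∘ opposite) (nextIdx-fromℕ k) ⟩
    a (fromℕ k)                               ∎

  cycleInv-suc : ∀ j → cycleInv _≟_ a (a (suc j)) ≡ a (inject₁ j)
  cycleInv-suc j = begin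
    cycleInv _≟_ a (a (suc j))                          ≡⟨ cong (cycleInv _≟_ a ∘ a) (opposite-involutive (suc j)) ⟨
    cycleInv _≟_ a (a (opposite (inject₁ (opposite j))))  ≡⟨ cycleInv-opposite (inject₁ (opposite j)) ⟩
    a (opposite (nextIdx (inject₁ (opposite j))))         ≡⟨ cong (a ∘ opposite) (nextIdx-inject₁ (opposite j)) ⟩
    a (inject₁ (opposite (opposite j)))                   ≡⟨ cong (a ∘ inject₁) (opposite-involutive j) ⟩
    a (inject₁ j)                                         ∎

module Construction {X : Set} (e : CountablyInfinite X) {k : ℕ}
                    (a : Fin (suc k) → X) (a-inj : Injective _≡_ _≡_ a) where

  open ≡-Reasoning

  _≟_ : DecidableEquality X
  _≟_ = decEqCI e

  _≟ᴱ_ : DecidableEquality (Ext X)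
  _≟ᴱ_ = ≡-dec _≟_ ⊤._≟_

  bound : ∃ λ M → ∀ i → Inverse.to e (a i) < M
  bound = strictUpperBound (Inverse.to e ∘ a)

  b : ℕ → X
  b = enumFrom e (proj₁ bound)

  b? : ∀ x → Dec (InDom b x)
  b? = inDom-enumFrom? e (proj₁ bound)

  a∉b : ∀ i → ¬ InDom b (a i)
  a∉b i = <⇒≱ (proj₂ bound i) ∘ inDom-enumFrom⁻ e

  c₁ c₂ : ℕ → Ext X
  c₁ = zPt ∷ˢ inj₁ (a zero) ∷ˢ inj₁ ∘ b
  c₂ = zPt ∷ˢ (inj₁ ∘ a) ++ˢ inj₁ ∘ b

  c₁? : ∀ y → Dec (InDom c₁ y)
  c₁? = inDom-∷ˢ? _≟ᴱ_ (inDom-∷ˢ? _≟ᴱ_ (inDom-inj₁? b?))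

  c₂? : ∀ y → Dec (InDom c₂ y)
  c₂? = inDom-∷ˢ? _≟ᴱ_ (inDom-++ˢ? _≟ᴱ_ {v = inj₁ ∘ a} (inDom-inj₁? b?))

  x∉c₁ : ∀ {x} → a zero ≢ x → ¬ InDom b x → ¬ InDom c₁ (inj₁ x)
  x∉c₁ a₀≢x x∉b =
    [ (λ ()) , [ a₀≢x ∘ inj₁-injective , x∉b ∘ inDom-∘⁻ inj₁-injective ] ∘ inDom-∷ˢ⁻ ] ∘ inDom-∷ˢ⁻

  x∉c₂ : ∀ {x} → ¬ (∃ λ i → a i ≡ x) → ¬ InDom b x → ¬ InDom c₂ (inj₁ x)
  x∉c₂ x∉a x∉b =
    [ (λ ()) , [ x∉a ∘ map₁′ , x∉b ∘ inDom-∘⁻ inj₁-injective ] ∘ inDom-++ˢ⁻ {v = inj₁ ∘ a} ] ∘ inDom-∷ˢ⁻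
    where
    map₁′ : ∀ {x} → ∃ (λ i → inj₁ (a i) ≡ inj₁ x) → ∃ λ i → a i ≡ x
    map₁′ (i , p) = i , inj₁-injective p

  c₁-distinct : Distinct c₁
  c₁-distinct =
    ∷ˢ-distinct ([ (λ ()) , (λ { (_ , ()) }) ] ∘ inDom-∷ˢ⁻)
      (∷ˢ-distinct (a∉b zero ∘ inDom-∘⁻ inj₁-injective)
        (distinct-∘ inj₁-injective (enumFrom-distinct e _)))

  c₂-distinct : Distinct c₂
  c₂-distinct =
    ∷ˢ-distinct ([ (λ { (_ , ()) }) , (λ { (_ , ()) }) ] ∘ inDom-++ˢ⁻ {v = inj₁ ∘ a})
      (++ˢ-distinct {v = inj₁ ∘ a} (a-inj ∘ inj₁-injective) (λ i → a∉b i ∘ inDom-∘⁻ inj₁-injective)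
        (distinct-∘ inj₁-injective (enumFrom-distinct e _)))

  f₁ : Ext X → Ext X
  f₁ = forgetfulSwap c₁ c₁?

  f₂ : Ext X → Maybe (Ext X)
  f₂ = retentiveSwap c₂ c₂?

  c₂-a : ∀ i → c₂ (suc (toℕ i)) ≡ inj₁ (a i)
  c₂-a = ++ˢ-lookup (inj₁ ∘ a) (inj₁ ∘ b)

  c₂-b : ∀ t → c₂ (suc (suc k + t)) ≡ inj₁ (b t)
  c₂-b = ++ˢ-drop (inj₁ ∘ a) (inj₁ ∘ b)

  f₁-shift : ∀ i → f₁ (c₁ i) ≡ c₁ (suc i)
  f₁-shift = forgetfulSwap-shift c₁ c₁? c₁-distinct

  f₂-shift : ∀ i → f₂ (c₂ (suc i)) ≡ just (c₂ i)
  f₂-shift = retentiveSwap-shift c₂ c₂? c₂-distinct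

  swaps-zPt : f₂ (f₁ zPt) ≡ just zPt
  swaps-zPt = trans (cong f₂ (f₁-shift 0)) (f₂-shift 0)

  swaps-a₀ : f₂ (f₁ (inj₁ (a zero))) ≡ just (inj₁ (a (fromℕ k)))
  swaps-a₀ = begin
    f₂ (f₁ (c₁ 1))                    ≡⟨ cong f₂ (f₁-shift 1) ⟩
    f₂ (inj₁ (b 0))                   ≡⟨ cong f₂ (c₂-b 0) ⟨
    f₂ (c₂ (suc (suc k + 0)))         ≡⟨ f₂-shift (suc k + 0) ⟩
    just (c₂ (suc (k + 0)))           ≡⟨ cong (just ∘ c₂ ∘ suc) (trans (+-identityʳ k) (sym (toℕ-fromℕ k))) ⟩
    just (c₂ (suc (toℕ (fromℕ k))))   ≡⟨ cong just (c₂-a (fromℕ k)) ⟩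
    just (inj₁ (a (fromℕ k)))         ∎

  swaps-a-suc : ∀ j → f₂ (f₁ (inj₁ (a (suc j)))) ≡ just (inj₁ (a (inject₁ j)))
  swaps-a-suc j = begin
    f₂ (f₁ (inj₁ (a (suc j))))          ≡⟨ cong f₂ (forgetfulSwap-fixes c₁ c₁? _ a-suc∉c₁) ⟩
    f₂ (inj₁ (a (suc j)))               ≡⟨ cong f₂ (c₂-a (suc j)) ⟨
    f₂ (c₂ (suc (suc (toℕ j))))         ≡⟨ f₂-shift (suc (toℕ j)) ⟩
    just (c₂ (suc (toℕ j)))             ≡⟨ cong (just ∘ c₂ ∘ suc) (toℕ-inject₁ j) ⟨
    just (c₂ (suc (toℕ (inject₁ j))))   ≡⟨ cong just (c₂-a (inject₁ j)) ⟩
    just (inj₁ (a (inject₁ j)))         ∎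
    where
    a-suc∉c₁ : ¬ InDom c₁ (inj₁ (a (suc j)))
    a-suc∉c₁ = x∉c₁ (0≢1+n ∘ a-inj) (a∉b (suc j))

  swaps-b : ∀ t → f₂ (f₁ (inj₁ (b t))) ≡ just (inj₁ (b t))
  swaps-b t = begin
    f₂ (f₁ (c₁ (2 + t)))              ≡⟨ cong f₂ (f₁-shift (2 + t)) ⟩
    f₂ (inj₁ (b (suc t)))             ≡⟨ cong f₂ (c₂-b (suc t)) ⟨
    f₂ (c₂ (suc (suc k + suc t)))     ≡⟨ f₂-shift (suc k + suc t) ⟩
    just (c₂ (suc k + suc t))         ≡⟨ cong (just ∘ c₂) (+-suc (suc k) t) ⟩
    just (c₂ (suc (suc k + t)))       ≡⟨ cong just (c₂-b t) ⟩
    just (inj₁ (b t))                 ∎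

  swaps-fresh : ∀ {x} → ¬ (∃ λ i → a i ≡ x) → ¬ InDom b x → f₂ (f₁ (inj₁ x)) ≡ just (inj₁ x)
  swaps-fresh x∉a x∉b = trans
    (cong f₂ (forgetfulSwap-fixes c₁ c₁? _ (x∉c₁ (λ p → x∉a (zero , p)) x∉b)))
    (retentiveSwap-fixes c₂ c₂? _ (x∉c₂ x∉a x∉b))

  swaps-off-a : ∀ {x} → ¬ (∃ λ i → a i ≡ x) → f₂ (f₁ (inj₁ x)) ≡ just (inj₁ x)
  -- Not a `with`: abstracting b? x would also abstract it inside the definition of f₁.
  swaps-off-a {x} x∉a = by-cases (b? x)
    where
    by-cases : Dec (InDom b x) → f₂ (f₁ (inj₁ x)) ≡ just (inj₁ x)
    by-cases (yes (t , refl)) = swaps-b t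
    by-cases (no x∉b) = swaps-fresh x∉a x∉b

  swaps-X : ∀ x → f₂ (f₁ (inj₁ x)) ≡ just (inj₁ (cycleInv _≟_ a x))
  swaps-X x with any? (λ i → a i ≟ x)
  ... | yes (zero , refl) = trans swaps-a₀ (cong (just ∘ inj₁) (sym (cycleInv-zero _≟_ a a-inj)))
  ... | yes (suc j , refl) = trans (swaps-a-suc j) (cong (just ∘ inj₁) (sym (cycleInv-suc _≟_ a a-inj j)))
  ... | no x∉a = trans (swaps-off-a x∉a) (cong (just ∘ inj₁) (sym (cycleInv-fixes _≟_ a x∉a)))

  swaps-defined : ∀ y → f₂ (f₁ y) ≢ nothing
  swaps-defined (inj₁ x) p with () ← trans (sym (swaps-X x)) p
  swaps-defined (inj₂ _) p with () ← trans (sym swaps-zPt) p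

  domains-differ : Fin k → ¬ (∀ y → InDom c₁ y ⇔ InDom c₂ y)
  domains-differ j same =
    x∉c₁ (0≢1+n ∘ a-inj) (a∉b (suc j)) (Equivalence.from (same _) (suc (toℕ (suc j)) , c₂-a (suc j)))

mainTheorem15 : (X : Set) (e : CountablyInfinite X) (n : ℕ) → n ≥ 2 →
    (a : Fin n → X) → Injective _≡_ _≡_ a →
    Σ (ℕ → Ext X) λ c₁ → Σ (Ext X → Ext X) λ f₁ →
    Σ (ℕ → Ext X) λ c₂ → Σ (Ext X → Maybe (Ext X)) λ f₂ →
      IsForgetfulSwap c₁ f₁ × IsRetentiveSwap c₂ f₂
      × InDom c₁ zPt × InDom c₂ zPt
      × ¬ (∀ y → InDom c₁ y ⇔ InDom c₂ y)
      × (∀ y → f₂ (f₁ y) ≢ nothing)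
      × (∀ x → f₂ (f₁ (inj₁ x)) ≡ just (inj₁ (cycleInv (decEqCI e) a x)))
      × (f₂ (f₁ zPt) ≡ just zPt)
mainTheorem15 X e (suc (suc m)) (s≤s (s≤s z≤n)) a a-inj =
  c₁ , f₁ , c₂ , f₂ ,
  forgetfulSwap-isForgetfulSwap c₁ c₁? c₁-distinct ,
  retentiveSwap-isRetentiveSwap c₂ c₂? c₂-distinct ,
  (0 , refl) , (0 , refl) ,
  domains-differ zero , swaps-defined , swaps-X , swaps-zPt
  where open Construction e a a-inj
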